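{- Let $k$ be a positive integer, and let $T_k=\{2i-1+(s-1)(2k+3)\mid 1\le s\le k,\ 1\le i\le k+1-s\}$ and $T'_k=\{2i+(s-1)(2k+3)\mid 1\le s\le k,\ 1\le i\le k+1-s\}$. Then the underlying set of $M_{2k+1,2k+3}$ is $T_k\cup T'_k$.
   Context: For coprime positive integers $s,t$, let $P_{s,t}=\mathbb{N}^+\setminus\{k_1s+k_2t\mid k_1,k_2\in\mathbb{N}\}$ (with $\mathbb N=\{0,1,2,\dots\}$), partially ordered by the reflexive-transitive closure of the cover relation: $x$ covers $y$ iff $x,y\in P_{s,t}$ and $x-y\in\{s,t\}$. $M_{2k+1,2k+3}$ is the subposet of $P_{2k+1,2k+3}$ obtained by removing all elements $y$ with $y\succeq 2k+2$. -}

module Defs where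

open import Data.Nat using (ℕ; zero; suc; _+_; _*_; _∸_; _≤_)
open import Data.Product using (Σ; ∃; _×_)
open import Data.Sum using (_⊎_)
open import Relation.Nullary using (¬_)
open import Relation.Binary.PropositionalEquality using (_≡_)
open import Relation.Binary.Construct.Closure.ReflexiveTransitive using (Star)

InSemigroup : ℕ → ℕ → ℕ → Set
InSemigroup s t n = Σ ℕ λ k₁ → Σ ℕ λ k₂ → n ≡ k₁ * s + k₂ * t

InP : ℕ → ℕ → ℕ → Set
InP s t x = (1 ≤ x) × ¬ InSemigroup s t x

Covers : ℕ → ℕ → ℕ → ℕ → Set
Covers s t x y = InP s t x × InP s t y × ((x ≡ y + s) ⊎ (x ≡ y + t))

Succeq : ℕ → ℕ → ℕ → ℕ → Set
Succeq s t x y = Star (Covers s t) x y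

InM : ℕ → ℕ → Set
InM k y = InP (2 * k + 1) (2 * k + 3) y × ¬ Succeq (2 * k + 1) (2 * k + 3) y (2 * k + 2)

InT : ℕ → ℕ → Set
InT k x = Σ ℕ λ s → Σ ℕ λ i →
  (1 ≤ s) × (s ≤ k) × (1 ≤ i) × (i ≤ k + 1 ∸ s) ×
  (x ≡ (2 * i ∸ 1) + (s ∸ 1) * (2 * k + 3))

InT' : ℕ → ℕ → Set
InT' k x = Σ ℕ λ s → Σ ℕ λ i →
  (1 ≤ s) × (s ≤ k) × (1 ≤ i) × (i ≤ k + 1 ∸ s) ×
  (x ≡ 2 * i + (s ∸ 1) * (2 * k + 3))

-- Write a = 2k+1 and b = a+2 = 2k+3, and x = r + c·a with r < a. If r ≤ 2c then x is either
-- in ⟨a,b⟩ (r = 2n gives x = (c-n)·a + n·b) or above 2k+2 (r = 2n+1 gives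
-- x = (2k+2) + (c-n-1)·a + n·b). If r > 2c then x = j + c·b with j = r - 2c, so
-- c·b < x < (c+1)·a and x is not in ⟨a,b⟩; the same holds for x - (2k+2) one layer lower,
-- so x ⋡ 2k+2. The numbers j + c·b with 1 ≤ j ≤ 2k - 2c are exactly T_k ∪ T'_k, split by
-- the parity of j.
module Submission where

open import Defs
open import Data.Nat using (ℕ; _≤_)
open import Data.Sum using (_⊎_)
open import Function.Bundles using (_⇔_)

open import Data.Nat using (zero; suc; _+_; _*_; _∸_; _<_; z≤n; s≤s; NonZero; >-nonZero)
open import Data.Nat.Properties
open import Data.Nat.DivMod using (_/_; _%_; m≡m%n+[m/n]*n; m%n<n)
open import Data.Nat.Tactic.RingSolver using (solve)
open import Data.List.Base using (_∷_; [])
open import Data.Product using (Σ; _×_; _,_; proj₁; proj₂)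
open import Data.Sum using (inj₁; inj₂)
open import Data.Empty using (⊥-elim)
open import Relation.Nullary using (¬_; yes; no)
open import Relation.Binary.PropositionalEquality
  using (_≡_; refl; sym; trans; cong; subst)
open import Relation.Binary.Construct.Closure.ReflexiveTransitive using (ε; _◅_)
open import Function.Bundles using (mk⇔; module Equivalence)
open Equivalence using (to; from)

even-or-odd : ∀ n → (Σ ℕ λ i → n ≡ 2 * i) ⊎ (Σ ℕ λ i → n ≡ 1 + 2 * i)
even-or-odd zero = inj₁ (0 , refl)
even-or-odd (suc n) with even-or-odd n
... | inj₁ (i , refl) = inj₂ (i , refl)
... | inj₂ (i , refl) = inj₁ (suc i , sym (*-suc 2 i))

module _ (a b : ℕ) where

  ∈⟨⟩-step : ∀ {z x} → InSemigroup a b z → x ≡ z + a ⊎ x ≡ z + b → InSemigroup a b x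
  ∈⟨⟩-step (k₁ , k₂ , refl) (inj₁ refl) = suc k₁ , k₂ , solve (k₁ ∷ k₂ ∷ a ∷ b ∷ [])
  ∈⟨⟩-step (k₁ , k₂ , refl) (inj₂ refl) = k₁ , suc k₂ , solve (k₁ ∷ k₂ ∷ a ∷ b ∷ [])

  covers-below : ∀ {x z} → InP a b x → 1 ≤ z → x ≡ z + a ⊎ x ≡ z + b → Covers a b x z
  covers-below px@(_ , x∉) z≥1 step = px , (z≥1 , λ z∈ → x∉ (∈⟨⟩-step z∈ step)) , step

  Succeq⇒gap : ∀ {x y} → Succeq a b x y → Σ ℕ λ d → InSemigroup a b d × x ≡ y + d
  Succeq⇒gap {x} ε = 0 , (0 , 0 , refl) , sym (+-identityʳ x)
  Succeq⇒gap ((_ , _ , inj₁ refl) ◅ rest) with Succeq⇒gap rest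
  ... | d , d∈ , refl = d + a , ∈⟨⟩-step d∈ (inj₁ refl) , +-assoc _ d a
  Succeq⇒gap ((_ , _ , inj₂ refl) ◅ rest) with Succeq⇒gap rest
  ... | d , d∈ , refl = d + b , ∈⟨⟩-step d∈ (inj₂ refl) , +-assoc _ d b

  gap⇒Succeq : ∀ {x y d} → InP a b x → 1 ≤ y → InSemigroup a b d → x ≡ y + d → Succeq a b x y
  gap⇒Succeq {y = y} px y≥1 (k₁ , k₂ , refl) refl = descend k₁ k₂ px
    where
    descend : ∀ k₁ k₂ → InP a b (y + (k₁ * a + k₂ * b)) → Succeq a b (y + (k₁ * a + k₂ * b)) y
    descend zero zero _ rewrite +-identityʳ y = ε
    descend (suc k₁) k₂ px = cover ◅ descend k₁ k₂ (proj₁ (proj₂ cover))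
      where
      cover : Covers a b (y + (suc k₁ * a + k₂ * b)) (y + (k₁ * a + k₂ * b))
      cover = covers-below px (≤-trans y≥1 (m≤m+n y _)) (inj₁ step)
        where
        step : y + (suc k₁ * a + k₂ * b) ≡ y + (k₁ * a + k₂ * b) + a
        step = solve (y ∷ k₁ ∷ k₂ ∷ a ∷ b ∷ [])
    descend zero (suc k₂) px = cover ◅ descend zero k₂ (proj₁ (proj₂ cover))
      where
      cover : Covers a b (y + (zero * a + suc k₂ * b)) (y + (zero * a + k₂ * b))
      cover = covers-below px (≤-trans y≥1 (m≤m+n y _)) (inj₂ step)
        where
        step : y + (zero * a + suc k₂ * b) ≡ y + (zero * a + k₂ * b) + b
        step = solve (y ∷ k₂ ∷ a ∷ b ∷ [])

  module _ (a≤b : a ≤ b) where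

    sum*min≤combination : ∀ k₁ k₂ → (k₁ + k₂) * a ≤ k₁ * a + k₂ * b
    sum*min≤combination k₁ k₂ = begin
      (k₁ + k₂) * a   ≡⟨ *-distribʳ-+ a k₁ k₂ ⟩
      k₁ * a + k₂ * a ≤⟨ +-monoʳ-≤ (k₁ * a) (*-monoʳ-≤ k₂ a≤b) ⟩
      k₁ * a + k₂ * b ∎
      where open ≤-Reasoning

    combination≤sum*max : ∀ k₁ k₂ → k₁ * a + k₂ * b ≤ (k₁ + k₂) * b
    combination≤sum*max k₁ k₂ = begin
      k₁ * a + k₂ * b ≤⟨ +-monoˡ-≤ (k₂ * b) (*-monoʳ-≤ k₁ a≤b) ⟩
      k₁ * b + k₂ * b ≡⟨ *-distribʳ-+ b k₁ k₂ ⟨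
      (k₁ + k₂) * b   ∎
      where open ≤-Reasoning

    ∉⟨⟩-between : ∀ c {y} → c * b < y → y < suc c * a → ¬ InSemigroup a b y
    ∉⟨⟩-between c cb<y y<a+ca (k₁ , k₂ , refl) with k₁ + k₂ ≤? c
    ... | yes k≤c = <-irrefl refl
          (<-≤-trans cb<y (≤-trans (combination≤sum*max k₁ k₂) (*-monoˡ-≤ b k≤c)))
    ... | no k≰c = <-irrefl refl
          (<-≤-trans y<a+ca (≤-trans (*-monoˡ-≤ a (≰⇒> k≰c)) (sum*min≤combination k₁ k₂)))

-- Layer c is row s = c + 1 of T_k ∪ T'_k, with j = 2i - 1 or j = 2i.
Layered : ℕ → ℕ → Set
Layered k x = Σ ℕ λ c → Σ ℕ λ j → (1 ≤ j) × (j + 2 * c ≤ 2 * k) × (x ≡ j + c * (2 * k + 3))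

layer-∉⟨⟩ : ∀ k c j → 1 ≤ j → j + 2 * c ≤ 2 * k →
            ¬ InSemigroup (2 * k + 1) (2 * k + 3) (j + c * (2 * k + 3))
layer-∉⟨⟩ k c j j≥1 j+2c≤2k =
  ∉⟨⟩-between (2 * k + 1) (2 * k + 3) (+-monoʳ-≤ (2 * k) (s≤s z≤n)) c
    (+-monoˡ-≤ (c * (2 * k + 3)) j≥1) below
  where
  open ≤-Reasoning
  below : j + c * (2 * k + 3) < suc c * (2 * k + 1)
  below = begin-strict
    j + c * (2 * k + 3)           ≡⟨ solve (j ∷ c ∷ k ∷ []) ⟩
    (j + 2 * c) + c * (2 * k + 1) ≤⟨ +-monoˡ-≤ (c * (2 * k + 1)) j+2c≤2k ⟩
    2 * k + c * (2 * k + 1)       <⟨ +-monoˡ-< (c * (2 * k + 1)) (m<m+n (2 * k) (s≤s z≤n)) ⟩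
    suc c * (2 * k + 1)           ∎

layer-⋡ : ∀ k c j → j + 2 * c ≤ 2 * k →
          ¬ Succeq (2 * k + 1) (2 * k + 3) (j + c * (2 * k + 3)) (2 * k + 2)
layer-⋡ k c j bound above with Succeq⇒gap (2 * k + 1) (2 * k + 3) above
layer-⋡ k zero j bound above | d , _ , x≡ = <-irrefl refl (begin-strict
  2 * k         <⟨ m<m+n (2 * k) (s≤s z≤n) ⟩
  2 * k + 2     ≤⟨ m≤m+n (2 * k + 2) d ⟩
  2 * k + 2 + d ≡⟨ x≡ ⟨
  j + 0         ≤⟨ bound ⟩
  2 * k         ∎)
  where open ≤-Reasoning
layer-⋡ k (suc c) j bound above | d , d∈ , x≡ =
  layer-∉⟨⟩ k c (suc j) (s≤s z≤n) lower-bound (subst (InSemigroup (2 * k + 1) (2 * k + 3)) d≡ d∈)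
  where
  d≡ : d ≡ suc j + c * (2 * k + 3)
  d≡ = +-cancelˡ-≡ (2 * k + 2) d _ (trans (sym x≡) (solve (j ∷ c ∷ k ∷ [])))
  lower-bound : suc j + 2 * c ≤ 2 * k
  lower-bound = begin
    suc j + 2 * c        ≤⟨ n≤1+n _ ⟩
    suc (suc j + 2 * c)  ≡⟨ solve (j ∷ c ∷ []) ⟩
    j + 2 * suc c        ≤⟨ bound ⟩
    2 * k                ∎
    where open ≤-Reasoning

Layered⇒InM : ∀ k {x} → Layered k x → InM k x
Layered⇒InM k (c , j , j≥1 , bound , refl) =
  (≤-trans j≥1 (m≤m+n j _) , layer-∉⟨⟩ k c j j≥1 bound) , layer-⋡ k c j bound

high-residue-layered : ∀ k r c → r < 2 * k + 1 → 2 * c < r → Layered k (r + c * (2 * k + 1))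
high-residue-layered k r c r<2k+1 2c<r with m≤n⇒∃[o]m+o≡n 2c<r
... | o , refl = c , suc o , s≤s z≤n , bound , solve (o ∷ c ∷ k ∷ [])
  where
  open ≤-Reasoning
  bound : suc o + 2 * c ≤ 2 * k
  bound = ≤-pred (begin-strict
    suc o + 2 * c       ≡⟨ solve (o ∷ c ∷ []) ⟩
    suc (2 * c) + o     <⟨ r<2k+1 ⟩
    2 * k + 1           ≡⟨ +-comm (2 * k) 1 ⟩
    suc (2 * k)         ∎)

even-residue-∈⟨⟩ : ∀ k n c → n ≤ c → InSemigroup (2 * k + 1) (2 * k + 3) (2 * n + c * (2 * k + 1))
even-residue-∈⟨⟩ k n c n≤c with m≤n⇒∃[o]m+o≡n n≤c
... | q , refl = q , n , solve (n ∷ q ∷ k ∷ [])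

odd-residue-gap : ∀ k n c → n < c → Σ ℕ λ d →
  InSemigroup (2 * k + 1) (2 * k + 3) d × (1 + 2 * n) + c * (2 * k + 1) ≡ (2 * k + 2) + d
odd-residue-gap k n c n<c with m≤n⇒∃[o]m+o≡n n<c
... | q , refl = q * (2 * k + 1) + n * (2 * k + 3) , (q , n , refl) , solve (n ∷ q ∷ k ∷ [])

residue-layered : ∀ k r c → r < 2 * k + 1 →
                  InM k (r + c * (2 * k + 1)) → Layered k (r + c * (2 * k + 1))
residue-layered k r c r<2k+1 ((x≥1 , x∉) , x⋡) with 2 * c <? r
... | yes 2c<r = high-residue-layered k r c r<2k+1 2c<r
... | no 2c≮r with even-or-odd r
...   | inj₁ (n , refl) = ⊥-elim (x∉ (even-residue-∈⟨⟩ k n c (*-cancelˡ-≤ 2 (≮⇒≥ 2c≮r))))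
...   | inj₂ (n , refl) with odd-residue-gap k n c (*-cancelˡ-< 2 n c (≮⇒≥ 2c≮r))
...     | d , d∈ , x≡ = ⊥-elim (x⋡ (gap⇒Succeq (2 * k + 1) (2 * k + 3) {y = 2 * k + 2}
                            (x≥1 , x∉) (≤-trans (s≤s z≤n) (m≤n+m 2 (2 * k))) d∈ x≡))

InM⇒Layered : ∀ k {x} → InM k x → Layered k x
InM⇒Layered k {x} x∈M =
  subst (Layered k) (sym x≡) (residue-layered k (x % (2 * k + 1)) (x / (2 * k + 1))
    (m%n<n x (2 * k + 1)) (subst (InM k) x≡ x∈M))
  where
  instance
    2k+1-nonZero : NonZero (2 * k + 1)
    2k+1-nonZero = >-nonZero (m≤n+m 1 (2 * k))
  x≡ : x ≡ x % (2 * k + 1) + (x / (2 * k + 1)) * (2 * k + 1)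
  x≡ = m≡m%n+[m/n]*n x (2 * k + 1)

index-bounds : ∀ k c i → (suc c ≤ k × suc i ≤ k + 1 ∸ suc c) ⇔ i + c < k
index-bounds k c i = mk⇔
  (λ (c<k , i≤) → ≤-pred (begin
    suc (suc (i + c)) ≡⟨ cong suc (+-suc i c) ⟨
    suc i + suc c     ≤⟨ m≤o∸n⇒m+n≤o (suc i) (≤-trans c<k (m≤m+n k 1)) i≤ ⟩
    k + 1             ≡⟨ +-comm k 1 ⟩
    suc k             ∎))
  (λ i+c<k → ≤-trans (s≤s (m≤n+m c i)) i+c<k , m+n≤o⇒m≤o∸n (suc i) (begin
    suc i + suc c     ≡⟨ cong suc (+-suc i c) ⟩
    suc (suc (i + c)) ≤⟨ s≤s i+c<k ⟩
    suc k             ≡⟨ +-comm 1 k ⟩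
    k + 1             ∎))
  where open ≤-Reasoning

odd-layer-bound : ∀ k c i → 1 + 2 * i + 2 * c ≤ 2 * k ⇔ i + c < k
odd-layer-bound k c i = mk⇔
  (λ h → *-cancelˡ-< 2 (i + c) k (subst (_≤ 2 * k) sum≡ h))
  (λ h → subst (_≤ 2 * k) (sym sum≡) (*-monoʳ-< 2 h))
  where
  sum≡ : 1 + 2 * i + 2 * c ≡ 1 + 2 * (i + c)
  sum≡ = solve (i ∷ c ∷ [])

even-layer-bound : ∀ k c i → 2 + 2 * i + 2 * c ≤ 2 * k ⇔ i + c < k
even-layer-bound k c i = mk⇔
  (λ h → *-cancelˡ-≤ 2 (subst (_≤ 2 * k) sum≡ h))
  (λ h → subst (_≤ 2 * k) (sym sum≡) (*-monoʳ-≤ 2 h))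
  where
  sum≡ : 2 + 2 * i + 2 * c ≡ 2 * suc (i + c)
  sum≡ = solve (i ∷ c ∷ [])

InT⇒Layered : ∀ k {x} → InT k x → Layered k x
InT⇒Layered k (suc c , suc i , s≤s z≤n , c<k , s≤s z≤n , i≤ , x≡) =
  c , 1 + 2 * i , s≤s z≤n ,
  from (odd-layer-bound k c i) (to (index-bounds k c i) (c<k , i≤)) ,
  trans x≡ (cong (λ j → j ∸ 1 + c * (2 * k + 3)) (*-suc 2 i))

InT'⇒Layered : ∀ k {x} → InT' k x → Layered k x
InT'⇒Layered k (suc c , suc i , s≤s z≤n , c<k , s≤s z≤n , i≤ , x≡) =
  c , 2 + 2 * i , s≤s z≤n ,
  from (even-layer-bound k c i) (to (index-bounds k c i) (c<k , i≤)) ,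
  trans x≡ (cong (_+ c * (2 * k + 3)) (*-suc 2 i))

Layered⇒InT⊎InT' : ∀ k {x} → Layered k x → InT k x ⊎ InT' k x
Layered⇒InT⊎InT' k (c , suc j , _ , bound , x≡) with even-or-odd j
... | inj₁ (i , refl) =
  let c<k , i≤ = from (index-bounds k c i) (to (odd-layer-bound k c i) bound)
  in inj₁ (suc c , suc i , s≤s z≤n , c<k , s≤s z≤n , i≤ ,
           trans x≡ (cong (λ j → j ∸ 1 + c * (2 * k + 3)) (sym (*-suc 2 i))))
... | inj₂ (i , refl) =
  let c<k , i≤ = from (index-bounds k c i) (to (even-layer-bound k c i) bound)
  in inj₂ (suc c , suc i , s≤s z≤n , c<k , s≤s z≤n , i≤ ,
           trans x≡ (cong (_+ c * (2 * k + 3)) (sym (*-suc 2 i))))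

lemma2 : (k : ℕ) → 1 ≤ k → (x : ℕ) → InM k x ⇔ (InT k x ⊎ InT' k x)
lemma2 k _ x = mk⇔
  (λ x∈M → Layered⇒InT⊎InT' k (InM⇒Layered k x∈M))
  (λ { (inj₁ x∈T) → Layered⇒InM k (InT⇒Layered k x∈T)
     ; (inj₂ x∈T') → Layered⇒InM k (InT'⇒Layered k x∈T') })
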